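{- Let $a: M_{2,2,2}(\{ -3,0\},\{ -1,2\})\to\mathbb{Z}_{\ge 0}$ be a function and let $X\in\{\mathrm{I},\mathrm{II}\}$. If $Q(B(X,5);a)$ is positive semidefinite, then $\sum_{A} a(A)\le 8$.
   Context: For sets of numbers $Z,Y$, $M_{2,2,2}(Z,Y)$ denotes the set of $2\times 4$ real matrices whose first two columns have entries in $Z$ and whose last two columns have entries in $Y$. For a finite set $\mathcal{N}$ of $2\times r$ matrices, a function $a:\mathcal{N}\to\mathbb{Z}_{\ge 0}$ and an $r\times r$ matrix $Q_{11}$, let $Q_{21}$ be the matrix obtained by stacking vertically $a(A)$ copies of each $A\in\mathcal{N}$, let $m=\sum_{A}a(A)$, let $Q_{22}=\begin{bmatrix}6&-3\\-3&6\end{bmatrix}^{\oplus m}$ (block diagonal), and put $Q(Q_{11};a)=\begin{bmatrix}Q_{11}&Q_{21}^\top\\ Q_{21}&Q_{22}\end{bmatrix}$. Define $B^{(\mathrm{I})}_{11}=\begin{bmatrix}4&-2\\-2&4\end{bmatrix}$, $B^{(\mathrm{II})}_{11}=\begin{bmatrix}4&-1\\-1&4\end{bmatrix}$, $B_{22}=\begin{bmatrix}6&-3\\-3&6\end{bmatrix}$, $B^{(5)}_{21}=\begin{bmatrix}-2&1\\1&-2\end{bmatrix}$, and $B(X,5)=\begin{bmatrix}B^{(X)}_{11}&B^{(5)\top}_{21}\\ B^{(5)}_{21}&B_{22}\end{bmatrix}$ for $X\in\{\mathrm{I},\mathrm{II}\}$. -}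

module Defs where

open import Data.Nat using (ℕ; zero; suc) renaming (_+_ to _+ℕ_; _*_ to _*ℕ_; _/_ to _/ℕ_)
open import Data.Integer using (ℤ; +_; -[1+_])
open import Data.Rational using (ℚ; 0ℚ; _≤_) renaming (_+_ to _+ℚ_; _*_ to _*ℚ_; _/_ to _/ℚ_)
open import Data.Fin using (Fin; toℕ; splitAt)
open import Data.Vec using (Vec; []; _∷_; lookup; toList)
open import Data.List using (List; []; _∷_; length; map; concatMap; concat; replicate)
open import Data.Nat.ListAction using (sum)
import Data.List as L
open import Data.Sum using (inj₁; inj₂)
open import Data.Bool using (if_then_else_)
open import Relation.Nullary.Decidable using (⌊_⌋)
import Data.Nat as ℕ
import Data.Fin as F

Mat24 : Set
Mat24 = Vec (Vec ℤ 4) 2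

SqMat : ℕ → Set
SqMat n = Fin n → Fin n → ℤ

fromRows : ∀ {n} → Vec (Vec ℤ n) n → SqMat n
fromRows M i j = lookup (lookup M i) j

rows2-2 : List ℤ → List ℤ → List (Vec ℤ 4)
rows2-2 Z Y =
  concatMap (λ z1 → concatMap (λ z2 → concatMap (λ y1 → map (λ y2 →
    z1 ∷ z2 ∷ y1 ∷ y2 ∷ []) Y) Y) Z) Z

-- M_{2,2,2}(Z,Y): all 2×4 matrices whose first two columns have entries in Z
-- and last two columns entries in Y (Z, Y given as duplicate-free lists).
M222 : List ℤ → List ℤ → List Mat24
M222 Z Y = concatMap (λ r1 → map (λ r2 → r1 ∷ r2 ∷ []) (rows2-2 Z Y)) (rows2-2 Z Y)

𝒩 : List Mat24
𝒩 = M222 (-[1+ 2 ] ∷ + 0 ∷ []) (-[1+ 0 ] ∷ + 2 ∷ [])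

total : (Mat24 → ℕ) → List Mat24 → ℕ
total a N = sum (map a N)

-- Rows of Q21: a(A) copies of each A ∈ N stacked vertically (2m rows).
Q21rows : (Mat24 → ℕ) → List Mat24 → List (Vec ℤ 4)
Q21rows a N = concatMap (λ A → concat (replicate (a A) (toList A))) N

-- entry (r,s) of B22^{⊕ m}: 6 on the diagonal, -3 in the same 2×2 block, 0 otherwise
Q22entry : ∀ {k} → Fin k → Fin k → ℤ
Q22entry r s =
  if ⌊ toℕ r ℕ.≟ toℕ s ⌋ then + 6
  else if ⌊ (toℕ r /ℕ 2) ℕ.≟ (toℕ s /ℕ 2) ⌋ then -[1+ 2 ] else + 0

Qmat : SqMat 4 → (a : Mat24 → ℕ) → (N : List Mat24) → SqMat (4 +ℕ length (Q21rows a N))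
Qmat Q11 a N i j with splitAt 4 i | splitAt 4 j
... | inj₁ p | inj₁ q = Q11 p q
... | inj₁ p | inj₂ s = lookup (L.lookup (Q21rows a N) s) p
... | inj₂ r | inj₁ q = lookup (L.lookup (Q21rows a N) r) q
... | inj₂ r | inj₂ s = Q22entry r s

data Case : Set where
  I II : Case

B11 : Case → Vec (Vec ℤ 2) 2
B11 I  = (+ 4 ∷ -[1+ 1 ] ∷ []) ∷ (-[1+ 1 ] ∷ + 4 ∷ []) ∷ []
B11 II = (+ 4 ∷ -[1+ 0 ] ∷ []) ∷ (-[1+ 0 ] ∷ + 4 ∷ []) ∷ []

B22 : Vec (Vec ℤ 2) 2
B22 = (+ 6 ∷ -[1+ 2 ] ∷ []) ∷ (-[1+ 2 ] ∷ + 6 ∷ []) ∷ []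

B21-5 : Vec (Vec ℤ 2) 2
B21-5 = (-[1+ 1 ] ∷ + 1 ∷ []) ∷ (+ 1 ∷ -[1+ 1 ] ∷ []) ∷ []

B : Case → SqMat 4
B X i j with splitAt 2 i | splitAt 2 j
... | inj₁ p | inj₁ q = lookup (lookup (B11 X) p) q
... | inj₁ p | inj₂ s = lookup (lookup B21-5 s) p
... | inj₂ r | inj₁ q = lookup (lookup B21-5 r) q
... | inj₂ r | inj₂ s = lookup (lookup B22 r) s

sumFin : ∀ n → (Fin n → ℚ) → ℚ
sumFin zero f = 0ℚ
sumFin (suc n) f = f F.zero +ℚ sumFin n (λ i → f (F.suc i))

toℚ : ℤ → ℚ
toℚ z = z /ℚ 1

quad : ∀ {n} → SqMat n → (Fin n → ℚ) → ℚ
quad {n} M x = sumFin n (λ i → sumFin n (λ j → x i *ℚ toℚ (M i j) *ℚ x j))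

-- positive semidefinite (tested on rational vectors)
PosSemidef : ∀ {n} → SqMat n → Set
PosSemidef M = ∀ x → 0ℚ ≤ quad M x

-- Write Q = [[Q11, Q21ᵀ], [Q21, Q22]] with Q22 = B22^{⊕m} and Q21 stacked from the blocks A.
-- Testing Q against (v, −Q22⁻¹ Q21 v) shows that the Schur complement Q11 − Q21ᵀ Q22⁻¹ Q21 is
-- positive semidefinite too: 0 ≤ vᵀ Q11 v − Σ_A a(A) (Av)ᵀ B22⁻¹ (Av) for every v.
-- Summing over four fixed test vectors v, each A ∈ M_{2,2,2}({−3,0},{−1,2}) contributes at most
-- −368/3 (case I) resp. −352/3 (case II), while the Q11 = B(X,5) term is 1032 resp. 1040,
-- so at most eight blocks fit.
module Submission where

open import Defs
open import Algebra.Bundles using (CommutativeRing)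
open import Data.Fin using (Fin; zero; suc; splitAt; toℕ)
open import Data.Integer using (ℤ; +_; -[1+_])
open import Data.List as List using (List; []; _∷_; length; concatMap; replicate; concat)
import Data.List.Properties as List
open import Data.List.Membership.Propositional.Properties using (∈-lookup)
open import Data.List.Relation.Unary.All as All using (All; all?)
import Data.List.Relation.Unary.All.Properties as All
open import Data.Nat as ℕ using (ℕ; _≤_; z≤n; s≤s)
import Data.Nat.Properties as ℕ
open import Data.Nat.DivMod using (m/n≡1+[m∸n]/n)
open import Data.Rational using (ℚ; 0ℚ; _/_; +-0-rawMonoid; _+_; _*_; -_; _≤?_; _<?_)
  renaming (_≤_ to _≤ℚ_; _<_ to _<ℚ_)
import Data.Rational.Properties as ℚ
open import Data.Rational.Solver using (module +-*-Solver)
open import Data.Sum as Sum using (_⊎_; inj₁; inj₂; [_,_])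
open import Data.Vec using (Vec; []; _∷_; lookup; toList)
open import Data.Vec.Functional using (_++_)
open import Function using (_∘_; flip; id)
open import Relation.Binary.PropositionalEquality
open import Relation.Nullary.Decidable using (from-yes; ⌊_⌋; ⌊⌋-map′)

open import Algebra.Definitions.RawMonoid +-0-rawMonoid using (_×_)
open import Algebra.Properties.Semiring.Sum (CommutativeRing.semiring ℚ.+-*-commutativeRing)
open +-*-Solver

sumFin≡sum : ∀ n (f : Fin n → ℚ) → sumFin n f ≡ sum f
sumFin≡sum ℕ.zero    f = refl
sumFin≡sum (ℕ.suc n) f = cong (_+_ (f zero)) (sumFin≡sum n (f ∘ suc))

∑-splitAt : ∀ m {n} (g : Fin m ⊎ Fin n → ℚ) →
  ∑[ i < m ℕ.+ n ] g (splitAt m i) ≡ ∑[ i < m ] g (inj₁ i) + ∑[ j < n ] g (inj₂ j)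
∑-splitAt ℕ.zero    g = sym (ℚ.+-identityˡ _)
∑-splitAt (ℕ.suc m) {n} g = begin
  g₀ + ∑[ i < m ℕ.+ n ] g′ (splitAt m i)  ≡⟨ cong (_+_ g₀) (∑-splitAt m g′) ⟩
  g₀ + (∑₁ + ∑₂)                          ≡⟨ ℚ.+-assoc g₀ ∑₁ ∑₂ ⟨
  (g₀ + ∑₁) + ∑₂                          ∎
  where
  open ≡-Reasoning
  g′ = g ∘ Sum.map suc id
  g₀ = g (inj₁ zero)
  ∑₁ = ∑[ i < m ] g′ (inj₁ i)
  ∑₂ = ∑[ j < n ] g (inj₂ j)

∑-mono-≤ : ∀ {n} {f g : Fin n → ℚ} → (∀ i → f i ≤ℚ g i) → sum f ≤ℚ sum g
∑-mono-≤ {ℕ.zero}  f≤g = ℚ.≤-refl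
∑-mono-≤ {ℕ.suc n} f≤g = ℚ.+-mono-≤ (f≤g zero) (∑-mono-≤ (f≤g ∘ suc))

×-antimono-≤ : ∀ {c} → c ≤ℚ 0ℚ → ∀ {m n} → m ≤ n → n × c ≤ℚ m × c
×-antimono-≤ c≤0 {n = ℕ.zero}  z≤n = ℚ.≤-refl
×-antimono-≤ c≤0 {n = ℕ.suc n} z≤n = ℚ.≤-trans
  (ℚ.+-mono-≤ c≤0 (×-antimono-≤ c≤0 {n = n} z≤n)) (ℚ.≤-reflexive (ℚ.+-identityˡ 0ℚ))
×-antimono-≤ {c} c≤0 (s≤s m≤n) = ℚ.+-monoʳ-≤ c (×-antimono-≤ c≤0 m≤n)

∑-lookup-≤-× : ∀ {A : Set} {c m} (f : A → ℚ) (xs : List A) →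
  All (λ x → f x ≤ℚ c) xs → c ≤ℚ 0ℚ → m ≤ length xs →
  ∑[ i < length xs ] f (List.lookup xs i) ≤ℚ m × c
∑-lookup-≤-× {c = c} {m} f xs f≤c c≤0 m≤n = begin
  ∑[ i < length xs ] f (List.lookup xs i)  ≤⟨ ∑-mono-≤ (λ i → All.lookup f≤c (∈-lookup i)) ⟩
  ∑[ i < length xs ] c                     ≡⟨ sum-replicate (length xs) ⟩
  length xs × c                            ≤⟨ ×-antimono-≤ c≤0 m≤n ⟩
  m × c                                    ∎
  where open ℚ.≤-Reasoning

Mat : ℕ → ℕ → Set
Mat m n = Fin m → Fin n → ℤ

bilinear : ∀ {m n} → Mat m n → (Fin m → ℚ) → (Fin n → ℚ) → ℚ
bilinear {m} {n} M x y = ∑[ i < m ] ∑[ j < n ] (x i * toℚ (M i j) * y j)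

quad≡bilinear : ∀ {n} (M : SqMat n) x → quad M x ≡ bilinear M x x
quad≡bilinear {n} M x = trans (sumFin≡sum n _) (sum-cong-≗ {n} (λ i → sumFin≡sum n _))

bilinear-cong : ∀ {m n} {M N : Mat m n} → (∀ i j → M i j ≡ N i j) →
  ∀ x y → bilinear M x y ≡ bilinear N x y
bilinear-cong {m} {n} M≡N x y =
  sum-cong-≗ {m} (λ i → sum-cong-≗ {n} (λ j → cong (λ e → x i * toℚ e * y j) (M≡N i j)))

zeroBlock : ∀ {m n} → Mat m n
zeroBlock _ _ = + 0

bilinear-zero : ∀ {m n} (x : Fin m → ℚ) (y : Fin n → ℚ) → bilinear zeroBlock x y ≡ 0ℚ
bilinear-zero {m} {n} x y = begin
  bilinear zeroBlock x y    ≡⟨ sum-cong-≗ {m} (λ i → sum-cong-≗ {n} (λ j → x*0*y≡0 (x i) (y j))) ⟩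
  ∑[ i < m ] ∑[ j < n ] 0ℚ  ≡⟨ sum-cong-≗ {m} (λ _ → sum-replicate-zero n) ⟩
  ∑[ i < m ] 0ℚ             ≡⟨ sum-replicate-zero m ⟩
  0ℚ                        ∎
  where
  open ≡-Reasoning
  x*0*y≡0 : ∀ a b → a * toℚ (+ 0) * b ≡ 0ℚ
  x*0*y≡0 a b = trans (cong (_* b) (ℚ.*-zeroʳ a)) (ℚ.*-zeroˡ b)

bilinear-transpose : ∀ {m n} (M : Mat m n) x y → bilinear (flip M) y x ≡ bilinear M x y
bilinear-transpose {m} {n} M x y = begin
  ∑[ j < n ] ∑[ i < m ] (y j * toℚ (M i j) * x i)
    ≡⟨ ∑-comm (λ j i → y j * toℚ (M i j) * x i) ⟩
  ∑[ i < m ] ∑[ j < n ] (y j * toℚ (M i j) * x i)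
    ≡⟨ sum-cong-≗ {m} (λ i → sum-cong-≗ {n} (λ j → swap (y j) (toℚ (M i j)) (x i))) ⟩
  bilinear M x y ∎
  where
  open ≡-Reasoning
  swap : ∀ a e b → a * e * b ≡ b * e * a
  swap = solve 3 (λ a e b → a :* e :* b := b :* e :* a) refl

bilinear-rows : ∀ {m n} (M : Mat m n) x y →
  bilinear M x y ≡ ∑[ i < m ] (x i * ∑[ j < n ] (toℚ (M i j) * y j))
bilinear-rows {m} {n} M x y = sum-cong-≗ {m} λ i → begin
  ∑[ j < n ] (x i * toℚ (M i j) * y j)
    ≡⟨ sum-cong-≗ {n} (λ j → ℚ.*-assoc (x i) (toℚ (M i j)) (y j)) ⟩
  ∑[ j < n ] (x i * (toℚ (M i j) * y j))
    ≡⟨ *-distribˡ-sum {n} (x i) (λ j → toℚ (M i j) * y j) ⟨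
  x i * ∑[ j < n ] (toℚ (M i j) * y j) ∎
  where open ≡-Reasoning

blocks : ∀ {k l} → Mat k k → Mat k l → Mat l k → Mat l l → Fin k ⊎ Fin l → Fin k ⊎ Fin l → ℤ
blocks A B C D (inj₁ p) (inj₁ q) = A p q
blocks A B C D (inj₁ p) (inj₂ s) = B p s
blocks A B C D (inj₂ r) (inj₁ q) = C r q
blocks A B C D (inj₂ r) (inj₂ s) = D r s

fromBlocks : ∀ {k l} → Mat k k → Mat k l → Mat l k → Mat l l → SqMat (k ℕ.+ l)
fromBlocks {k} A B C D i j = blocks A B C D (splitAt k i) (splitAt k j)

bilinear-fromBlocks : ∀ {k l} A B C D (v : Fin k → ℚ) (y : Fin l → ℚ) →
  bilinear (fromBlocks A B C D) (v ++ y) (v ++ y) ≡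
  (bilinear A v v + bilinear B v y) + (bilinear C y v + bilinear D y y)
bilinear-fromBlocks {k} {l} A B C D v y = begin
  ∑[ i < k ℕ.+ l ] row (splitAt k i)                ≡⟨ ∑-splitAt k row ⟩
  ∑[ p < k ] row (inj₁ p) + ∑[ r < l ] row (inj₂ r)  ≡⟨ cong₂ _+_ (splitRow inj₁) (splitRow inj₂) ⟩
  (bilinear A v v + bilinear B v y) + (bilinear C y v + bilinear D y y) ∎
  where
  open ≡-Reasoning
  entry : Fin k ⊎ Fin l → Fin k ⊎ Fin l → ℚ
  entry a b = [ v , y ] a * toℚ (blocks A B C D a b) * [ v , y ] b
  row : Fin k ⊎ Fin l → ℚ
  row a = ∑[ j < k ℕ.+ l ] entry a (splitAt k j)
  splitRow : ∀ {n} (ι : Fin n → Fin k ⊎ Fin l) →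
    ∑[ i < n ] row (ι i) ≡ ∑[ i < n ] ∑[ q < k ] entry (ι i) (inj₁ q) + ∑[ i < n ] ∑[ s < l ] entry (ι i) (inj₂ s)
  splitRow {n} ι = trans (sum-cong-≗ {n} (λ i → ∑-splitAt k (entry (ι i)))) (∑-distrib-+ {n} _ _)

half-suc-suc : ∀ t → ℕ.suc (ℕ.suc t) ℕ./ 2 ≡ ℕ.suc (t ℕ./ 2)
half-suc-suc t = m/n≡1+[m∸n]/n {ℕ.suc (ℕ.suc t)} {2} (s≤s (s≤s z≤n))

-- ⌊ m ≟ n ⌋ is stuck on variables, and its evidence has a different type after shifting by suc.
⌊suc≟suc⌋ : ∀ m n → ⌊ ℕ.suc m ℕ.≟ ℕ.suc n ⌋ ≡ ⌊ m ℕ.≟ n ⌋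
⌊suc≟suc⌋ m n = trans (⌊⌋-map′ _ _ _) (sym (⌊⌋-map′ _ _ _))

Q22entry-blocks : ∀ {n} (r s : Fin (2 ℕ.+ n)) →
  Q22entry r s ≡ fromBlocks (fromRows B22) zeroBlock zeroBlock Q22entry r s
Q22entry-blocks zero          zero          = refl
Q22entry-blocks zero          (suc zero)    = refl
Q22entry-blocks (suc zero)    zero          = refl
Q22entry-blocks (suc zero)    (suc zero)    = refl
Q22entry-blocks zero          (suc (suc s)) rewrite half-suc-suc (toℕ s) = refl
Q22entry-blocks (suc zero)    (suc (suc s)) rewrite half-suc-suc (toℕ s) = refl
Q22entry-blocks (suc (suc r)) zero          rewrite half-suc-suc (toℕ r) = refl
Q22entry-blocks (suc (suc r)) (suc zero)    rewrite half-suc-suc (toℕ r) = refl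
Q22entry-blocks (suc (suc r)) (suc (suc s))
  rewrite half-suc-suc (toℕ r) | half-suc-suc (toℕ s)
        | ⌊suc≟suc⌋ (ℕ.suc (toℕ r)) (ℕ.suc (toℕ s)) | ⌊suc≟suc⌋ (toℕ r) (toℕ s)
        | ⌊suc≟suc⌋ (toℕ r ℕ./ 2) (toℕ s ℕ./ 2) = refl

bilinear-Q22-++ : ∀ {n} (w : Fin 2 → ℚ) (z : Fin n → ℚ) →
  bilinear Q22entry (w ++ z) (w ++ z) ≡ bilinear (fromRows B22) w w + bilinear Q22entry z z
bilinear-Q22-++ w z = begin
  bilinear Q22entry (w ++ z) (w ++ z)
    ≡⟨ bilinear-cong Q22entry-blocks (w ++ z) (w ++ z) ⟩
  bilinear (fromBlocks (fromRows B22) zeroBlock zeroBlock Q22entry) (w ++ z) (w ++ z)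
    ≡⟨ bilinear-fromBlocks (fromRows B22) zeroBlock zeroBlock Q22entry w z ⟩
  (b + bilinear zeroBlock w z) + (bilinear zeroBlock z w + q)
    ≡⟨ cong₂ _+_ (cong (_+_ b) (bilinear-zero w z)) (cong (_+ q) (bilinear-zero z w)) ⟩
  (b + 0ℚ) + (0ℚ + q)
    ≡⟨ cong₂ _+_ (ℚ.+-identityʳ b) (ℚ.+-identityˡ q) ⟩
  b + q ∎
  where
  open ≡-Reasoning
  b = bilinear (fromRows B22) w w
  q = bilinear Q22entry z z

rowMatrix : ∀ {k} (R : List (Vec ℤ k)) → Mat (length R) k
rowMatrix R s q = lookup (List.lookup R s) q

QofRows : ∀ {k} → SqMat k → (R : List (Vec ℤ k)) → SqMat (k ℕ.+ length R)
QofRows Q11 R = fromBlocks Q11 (flip (rowMatrix R)) (rowMatrix R) Q22entry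

Qmat≡QofRows : ∀ Q11 a N i j → Qmat Q11 a N i j ≡ QofRows Q11 (Q21rows a N) i j
Qmat≡QofRows Q11 a N i j with splitAt 4 i | splitAt 4 j
... | inj₁ p | inj₁ q = refl
... | inj₁ p | inj₂ s = refl
... | inj₂ r | inj₁ q = refl
... | inj₂ r | inj₂ s = refl

dot : ∀ {k} → Vec ℤ k → (Fin k → ℚ) → ℚ
dot {k} r v = ∑[ q < k ] (toℚ (lookup r q) * v q)

rowsOf : ∀ {k} → List (Vec (Vec ℤ k) 2) → List (Vec ℤ k)
rowsOf = concatMap toList

-- B22⁻¹ = (1/9) [[2, 1], [1, 2]]; optimalPair w = −B22⁻¹ w and pairGain w = −wᵀ B22⁻¹ w.
pairGain : ℚ → ℚ → ℚ
pairGain w₀ w₁ = - (+ 2 / 9 * (w₀ * w₀ + w₀ * w₁ + w₁ * w₁))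

optimalPair : ℚ → ℚ → Fin 2 → ℚ
optimalPair w₀ w₁ zero       = - (+ 1 / 9 * (w₀ + w₀ + w₁))
optimalPair w₀ w₁ (suc zero) = - (+ 1 / 9 * (w₀ + w₁ + w₁))

optimalPair-gain : ∀ w₀ w₁ → let y = optimalPair w₀ w₁ in
  ((y zero * w₀ + y (suc zero) * w₁) + (y zero * w₀ + y (suc zero) * w₁)) + bilinear (fromRows B22) y y ≡
  pairGain w₀ w₁
optimalPair-gain = solve 2 (λ w₀ w₁ →
  let y₀ = :- (con (+ 1 / 9) :* (w₀ :+ w₀ :+ w₁))
      y₁ = :- (con (+ 1 / 9) :* (w₀ :+ w₁ :+ w₁))
      row = λ y e₀ e₁ → y :* con (toℚ e₀) :* y₀ :+ (y :* con (toℚ e₁) :* y₁ :+ con 0ℚ)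
  in ((y₀ :* w₀ :+ y₁ :* w₁) :+ (y₀ :* w₀ :+ y₁ :* w₁)) :+
     (row y₀ (+ 6) -[1+ 2 ] :+ (row y₁ -[1+ 2 ] (+ 6) :+ con 0ℚ))
  := :- (con (+ 2 / 9) :* (w₀ :* w₀ :+ w₀ :* w₁ :+ w₁ :* w₁))) refl

schurGain : ∀ {k} → Vec (Vec ℤ k) 2 → (Fin k → ℚ) → ℚ
schurGain (r₁ ∷ r₂ ∷ []) v = pairGain (dot r₁ v) (dot r₂ v)

optimalTail : ∀ {k} → (Fin k → ℚ) → (As : List (Vec (Vec ℤ k) 2)) → Fin (length (rowsOf As)) → ℚ
optimalTail v []                    = λ ()
optimalTail v ((r₁ ∷ r₂ ∷ []) ∷ As) = optimalPair (dot r₁ v) (dot r₂ v) ++ optimalTail v As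

optimalTail-gain : ∀ {k} (v : Fin k → ℚ) (As : List (Vec (Vec ℤ k) 2)) →
  let y = optimalTail v As
      c = ∑[ s < length (rowsOf As) ] (y s * dot (List.lookup (rowsOf As) s) v)
  in (c + c) + bilinear Q22entry y y ≡ ∑[ i < length As ] schurGain (List.lookup As i) v
optimalTail-gain v [] = refl
optimalTail-gain v ((r₁ ∷ r₂ ∷ []) ∷ As) = begin
  ((a + (b + c)) + (a + (b + c))) + bilinear Q22entry (y ++ z) (y ++ z)
    ≡⟨ cong (_+_ ((a + (b + c)) + (a + (b + c)))) (bilinear-Q22-++ y z) ⟩
  ((a + (b + c)) + (a + (b + c))) + (p + q)
    ≡⟨ regroup a b c p q ⟩
  ((a + b) + (a + b) + p) + ((c + c) + q)
    ≡⟨ cong₂ _+_ (optimalPair-gain d₁ d₂) (optimalTail-gain v As) ⟩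
  pairGain d₁ d₂ + ∑[ i < length As ] schurGain (List.lookup As i) v ∎
  where
  open ≡-Reasoning
  d₁ = dot r₁ v
  d₂ = dot r₂ v
  y = optimalPair d₁ d₂
  z = optimalTail v As
  a = y zero * d₁
  b = y (suc zero) * d₂
  c = ∑[ s < length (rowsOf As) ] (z s * dot (List.lookup (rowsOf As) s) v)
  p = bilinear (fromRows B22) y y
  q = bilinear Q22entry z z
  regroup : ∀ a b c p q →
    ((a + (b + c)) + (a + (b + c))) + (p + q) ≡ ((a + b) + (a + b) + p) + ((c + c) + q)
  regroup = solve 5 (λ a b c p q →
    ((a :+ (b :+ c)) :+ (a :+ (b :+ c))) :+ (p :+ q) := ((a :+ b) :+ (a :+ b) :+ p) :+ ((c :+ c) :+ q)) refl

bilinear-QofRows-optimalTail : ∀ {k} (Q11 : SqMat k) (As : List (Vec (Vec ℤ k) 2)) v →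
  let x = v ++ optimalTail v As in
  bilinear (QofRows Q11 (rowsOf As)) x x ≡ bilinear Q11 v v + ∑[ i < length As ] schurGain (List.lookup As i) v
bilinear-QofRows-optimalTail Q11 As v = begin
  bilinear (QofRows Q11 R) (v ++ y) (v ++ y)
    ≡⟨ bilinear-fromBlocks Q11 (flip M) M Q22entry v y ⟩
  (P + bilinear (flip M) v y) + (bilinear M y v + q)
    ≡⟨ cong (λ t → (P + t) + (bilinear M y v + q)) (bilinear-transpose M y v) ⟩
  (P + bilinear M y v) + (bilinear M y v + q)
    ≡⟨ regroup P (bilinear M y v) q ⟩
  P + ((bilinear M y v + bilinear M y v) + q)
    ≡⟨ cong (λ c → P + ((c + c) + q)) (bilinear-rows M y v) ⟩
  P + ((c + c) + q)
    ≡⟨ cong (_+_ P) (optimalTail-gain v As) ⟩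
  P + ∑[ i < length As ] schurGain (List.lookup As i) v ∎
  where
  open ≡-Reasoning
  R = rowsOf As
  M = rowMatrix R
  y = optimalTail v As
  P = bilinear Q11 v v
  q = bilinear Q22entry y y
  c = ∑[ s < length R ] (y s * dot (List.lookup R s) v)
  regroup : ∀ P c q → (P + c) + (c + q) ≡ P + ((c + c) + q)
  regroup = solve 3 (λ P c q → (P :+ c) :+ (c :+ q) := P :+ ((c :+ c) :+ q)) refl

PosSemidef⇒∑-schur-nonneg : ∀ {k c} (Q11 : SqMat k) (As : List (Vec (Vec ℤ k) 2)) (vs : Fin c → Fin k → ℚ) →
  PosSemidef (QofRows Q11 (rowsOf As)) →
  0ℚ ≤ℚ ∑[ t < c ] bilinear Q11 (vs t) (vs t) + ∑[ i < length As ] ∑[ t < c ] schurGain (List.lookup As i) (vs t)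
PosSemidef⇒∑-schur-nonneg {k} {c} Q11 As vs psd = begin
  0ℚ                                           ≡⟨ sum-replicate-zero c ⟨
  ∑[ t < c ] 0ℚ                                ≤⟨ ∑-mono-≤ atVector ⟩
  ∑[ t < c ] (P t + ∑[ i < length As ] G i t)  ≡⟨ ∑-distrib-+ P _ ⟩
  ∑[ t < c ] P t + ∑[ t < c ] ∑[ i < length As ] G i t
    ≡⟨ cong (_+_ (∑[ t < c ] P t)) (∑-comm (flip G)) ⟩
  ∑[ t < c ] P t + ∑[ i < length As ] ∑[ t < c ] G i t ∎
  where
  open ℚ.≤-Reasoning
  P : Fin c → ℚ
  P t = bilinear Q11 (vs t) (vs t)
  G : Fin (length As) → Fin c → ℚ
  G i t = schurGain (List.lookup As i) (vs t)
  atVector : ∀ t → 0ℚ ≤ℚ P t + ∑[ i < length As ] G i t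
  atVector t = subst (0ℚ ≤ℚ_)
    (trans (quad≡bilinear (QofRows Q11 (rowsOf As)) x) (bilinear-QofRows-optimalTail Q11 As (vs t)))
    (psd x)
    where x = vs t ++ optimalTail (vs t) As

copies : ∀ {A : Set} → (A → ℕ) → List A → List A
copies a = concatMap (λ A → replicate (a A) A)

length-copies : ∀ a N → length (copies a N) ≡ total a N
length-copies a [] = refl
length-copies a (A ∷ N) = begin
  length (replicate (a A) A List.++ copies a N)
    ≡⟨ List.length-++ (replicate (a A) A) ⟩
  length (replicate (a A) A) ℕ.+ length (copies a N)
    ≡⟨ cong₂ ℕ._+_ (List.length-replicate (a A)) (length-copies a N) ⟩
  a A ℕ.+ total a N ∎
  where open ≡-Reasoning

rowsOf-copies : ∀ a N → rowsOf (copies a N) ≡ Q21rows a N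
rowsOf-copies a [] = refl
rowsOf-copies a (A ∷ N) = begin
  rowsOf (replicate (a A) A List.++ copies a N)
    ≡⟨ List.concatMap-++ toList (replicate (a A) A) (copies a N) ⟩
  rowsOf (replicate (a A) A) List.++ rowsOf (copies a N)
    ≡⟨ cong₂ List._++_ (cong concat (List.map-replicate toList (a A) A)) (rowsOf-copies a N) ⟩
  concat (replicate (a A) (toList A)) List.++ Q21rows a N ∎
  where open ≡-Reasoning

All-copies : ∀ {A : Set} {P : A → Set} a {N} → All P N → All P (copies a N)
All-copies a pN = All.concat⁺ (All.map⁺ (All.map (λ {A} pA → All.replicate⁺ (a A) pA) pN))

PosSemidef-QofRows : ∀ Q11 a N → PosSemidef (Qmat Q11 a N) → PosSemidef (QofRows Q11 (rowsOf (copies a N)))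
PosSemidef-QofRows Q11 a N psd rewrite rowsOf-copies a N = λ x → subst (0ℚ ≤ℚ_)
  (trans (quad≡bilinear (Qmat Q11 a N) x)
    (trans (bilinear-cong (Qmat≡QofRows Q11 a N) x x) (sym (quad≡bilinear (QofRows Q11 (Q21rows a N)) x))))
  (psd x)

-- Test vectors found numerically.
certificate : Case → Fin 4 → Fin 4 → ℚ
certificate X t p = toℚ (lookup (lookup (rows X) t) p)
  where
  rows : Case → Vec (Vec ℤ 4) 4
  rows I  = (+ 0 ∷ + 2 ∷ + 3 ∷ + 9 ∷ []) ∷ (-[1+ 1 ] ∷ -[1+ 3 ] ∷ -[1+ 2 ] ∷ -[1+ 4 ] ∷ []) ∷
            (-[1+ 3 ] ∷ + 0 ∷ -[1+ 4 ] ∷ + 5 ∷ []) ∷ (-[1+ 1 ] ∷ -[1+ 5 ] ∷ + 3 ∷ -[1+ 2 ] ∷ []) ∷ []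
  rows II = (-[1+ 3 ] ∷ -[1+ 2 ] ∷ + 0 ∷ + 2 ∷ []) ∷ (+ 5 ∷ + 1 ∷ + 3 ∷ + 0 ∷ []) ∷
            (-[1+ 3 ] ∷ + 2 ∷ -[1+ 7 ] ∷ + 2 ∷ []) ∷ (+ 2 ∷ + 2 ∷ + 7 ∷ + 10 ∷ []) ∷ []

certificateGain : Case → Mat24 → ℚ
certificateGain X A = ∑[ t < 4 ] schurGain A (certificate X t)

gainBound : Case → ℚ
gainBound I  = - (+ 368 / 3)
gainBound II = - (+ 352 / 3)

certificateGain≤gainBound : ∀ X → All (λ A → certificateGain X A ≤ℚ gainBound X) 𝒩
certificateGain≤gainBound I  = from-yes (all? (λ A → certificateGain I A ≤? gainBound I) 𝒩)
certificateGain≤gainBound II = from-yes (all? (λ A → certificateGain II A ≤? gainBound II) 𝒩)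

gainBound≤0 : ∀ X → gainBound X ≤ℚ 0ℚ
gainBound≤0 I  = from-yes (gainBound I ≤? 0ℚ)
gainBound≤0 II = from-yes (gainBound II ≤? 0ℚ)

certificateValue : Case → ℚ
certificateValue X = ∑[ t < 4 ] bilinear (B X) (certificate X t) (certificate X t) + 9 × gainBound X

certificateValue<0 : ∀ X → certificateValue X <ℚ 0ℚ
certificateValue<0 I  = from-yes (certificateValue I <? 0ℚ)
certificateValue<0 II = from-yes (certificateValue II <? 0ℚ)

lemma4p7 : (a : Mat24 → ℕ) (X : Case) →
    PosSemidef (Qmat (B X) a 𝒩) → total a 𝒩 ≤ 8
lemma4p7 a X psd = ℕ.≮⇒≥ λ 9≤total →
  ℚ.<-irrefl refl (ℚ.≤-<-trans (bound 9≤total) (certificateValue<0 X))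
  where
  open ℚ.≤-Reasoning
  As = copies a 𝒩
  S = ∑[ t < 4 ] bilinear (B X) (certificate X t) (certificate X t)
  bound : 9 ≤ total a 𝒩 → 0ℚ ≤ℚ certificateValue X
  bound 9≤total = begin
    0ℚ
      ≤⟨ PosSemidef⇒∑-schur-nonneg (B X) As (certificate X) (PosSemidef-QofRows (B X) a 𝒩 psd) ⟩
    S + ∑[ i < length As ] certificateGain X (List.lookup As i)
      ≤⟨ ℚ.+-monoʳ-≤ S (∑-lookup-≤-× (certificateGain X) As
           (All-copies a (certificateGain≤gainBound X)) (gainBound≤0 X)
           (subst (9 ≤_) (sym (length-copies a 𝒩)) 9≤total)) ⟩
    certificateValue X ∎
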